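{- Suppose $X\subseteq{}^\omega\omega$, $\bar A,\bar B\in Q$, $\bar B\le^*\bar A$, and $[p_s(\bar A)]\cap X=\emptyset$ for all $s\in{}^{<\omega}\omega$. Then $[p_s(\bar B)]\cap X=\emptyset$ for all $s\in{}^{<\omega}\omega$.
   Context: A tree on ${}^{<\omega}\omega$ is a nonempty subset closed under initial segments; $[p]$ is its set of infinite branches; $Succ_p(s)=\{n:s^\frown n\in p\}$. A Laver tree is a tree $p$ with a stem (maximal node comparable with all nodes) such that $Succ_p(s)$ is infinite for all $s\in p$ extending the stem. $Q$ is the set of sequences $\bar A=\langle A_s:s\in{}^{<\omega}\omega\rangle$ with each $A_s\in[\omega]^\omega$. For $\bar A\in Q$, $p_s(\bar A)$ is the unique Laver tree with stem $s$ such that $Succ_{p_s(\bar A)}(t)=A_t$ for every $t\in p_s(\bar A)$ extending $s$. $\bar B\le^*\bar A$ means $B_s\subseteq^* A_s$ for all $s$ and $B_s\subseteq A_s$ for all but finitely many $s$ ($\subseteq^*$ is inclusion modulo finite). -}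

module Defs where

open import Data.Nat using (ℕ; _≤_)
open import Data.List using (List; _++_; _∷ʳ_; map; upTo)
open import Data.List.Membership.Propositional using (_∈_)
open import Data.Product using (Σ; ∃; _×_)
open import Relation.Binary.PropositionalEquality using (_≡_)
open import Relation.Nullary using (¬_)

Baire : Set
Baire = ℕ → ℕ

Seq : Set
Seq = List ℕ

SubsetN : Set₁
SubsetN = ℕ → Set

Infinite : SubsetN → Set
Infinite A = ∀ n → ∃ λ m → n ≤ m × A m

_⊆_ : SubsetN → SubsetN → Set
A ⊆ B = ∀ n → A n → B n

_⊆*_ : SubsetN → SubsetN → Set
A ⊆* B = ∃ λ k → ∀ n → k ≤ n → A n → B n

record InfSet : Set₁ where
  field
    set      : SubsetN
    infinite : Infinite set
open InfSet public

Q : Set₁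
Q = Seq → InfSet

Prefix : Seq → Seq → Set
Prefix s t = ∃ λ u → s ++ u ≡ t

-- the nodes of p_s(Ā): the Laver tree with stem s and Succ(t) = A_t for t ⊇ s
data InLaver (A : Q) (s : Seq) : Seq → Set where
  below : ∀ {t} → Prefix t s → InLaver A s t
  step  : ∀ {t n} → InLaver A s t → Prefix s t → set (A t) n → InLaver A s (t ∷ʳ n)

restrict : Baire → ℕ → Seq
restrict x n = map x (upTo n)

InBranches : Q → Seq → Baire → Set
InBranches A s x = ∀ n → InLaver A s (restrict x n)

_≤*_ : Q → Q → Set
B ≤* A = (∀ s → set (B s) ⊆* set (A s))
       × (∃ λ (L : List Seq) → ∀ s → ¬ (s ∈ L) → set (B s) ⊆ set (A s))

-- Only the finitely many exceptional nodes of B̄ ≤* Ā matter.  Let x ∈ [p_s(B̄)], and pick N at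
-- least |s| and longer than every node t with B_t ⊈ A_t.  For n ≥ N the node x↾n extends s
-- and is not exceptional, so x(n) ∈ B_{x↾n} ⊆ A_{x↾n}; hence x ∈ [p_{x↾N}(Ā)], which misses X.
module Submission where

open import Defs
open import Data.Product using (_×_; _,_)
open import Data.Empty using (⊥-elim)
open import Relation.Nullary using (¬_; yes; no)
open import Data.Nat using (ℕ; zero; suc; _≤_; _<_; _≤′_; ≤′-refl; ≤′-step; _⊔_; z≤n; _≤?_)
open import Data.Nat.Properties
  using (≤-totalOrder; ≤-trans; <-≤-trans; ≤-<-trans; <-irrefl; ≤⇒≤′; ≰⇒>; ≤-pred; m≤m⊔n; m≤n⊔m;
         +-comm; m≤m+n)
open import Data.List using (List; []; _∷_; _++_; _∷ʳ_; map; upTo; length)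
open import Data.List.Properties
  using (length-map; length-upTo; length-++; upTo-∷ʳ; map-++; ∷ʳ-injective; ++-assoc; ++-identityʳ)
open import Data.List.Extrema ≤-totalOrder using (max; xs≤max)
open import Data.List.Membership.Propositional using (_∈_)
open import Data.List.Membership.Propositional.Properties using (∈-map⁺)
open import Data.List.Relation.Unary.All using (lookup)
open import Relation.Binary.PropositionalEquality using (_≡_; refl; sym; trans; cong; subst)

prefix-length : ∀ {s t : Seq} → Prefix s t → length s ≤ length t
prefix-length {s} (u , refl) = subst (length s ≤_) (sym (length-++ s)) (m≤m+n _ _)

prefix-trans : ∀ {r s t : Seq} → Prefix r s → Prefix s t → Prefix r t
prefix-trans {r} (u , refl) (v , refl) = u ++ v , sym (++-assoc r u v)

length-restrict : ∀ x n → length (restrict x n) ≡ n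
length-restrict x n = trans (length-map x (upTo n)) (length-upTo n)

restrict-suc : ∀ x n → restrict x (suc n) ≡ restrict x n ∷ʳ x n
restrict-suc x n = trans (cong (map x) (sym (upTo-∷ʳ n))) (map-++ x (upTo n) (n ∷ []))

restrict-prefix : ∀ x {m n} → m ≤′ n → Prefix (restrict x m) (restrict x n)
restrict-prefix x ≤′-refl = [] , ++-identityʳ _
restrict-prefix x {n = suc n} (≤′-step m≤′n) =
  prefix-trans (restrict-prefix x m≤′n) (x n ∷ [] , sym (restrict-suc x n))

-- A `below` node is a prefix of the stem, hence too short to be of the form t ∷ʳ n.
InLaver-succ : ∀ {A s t n} → InLaver A s (t ∷ʳ n) → length s ≤ length t → set (A t) n
InLaver-succ p = go p refl
  where
  go : ∀ {A s u t n} → InLaver A s u → u ≡ t ∷ʳ n → length s ≤ length t → set (A t) n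
  go {s = s} {t = t} (below u≤s) refl |s|≤|t| = ⊥-elim (<-irrefl refl (<-≤-trans |t|<|s| |s|≤|t|))
    where
    |t|<|s| : length t < length s
    |t|<|s| = subst (_≤ length s) (trans (length-++ t) (+-comm (length t) 1)) (prefix-length u≤s)
  go (step {t} _ _ n∈A) eq _ with ∷ʳ-injective t _ eq
  ... | refl , refl = n∈A

InBranches-succ : ∀ {A s x} → InBranches A s x → ∀ n → length s ≤ n → set (A (restrict x n)) (x n)
InBranches-succ {s = s} {x} x∈p n |s|≤n =
  InLaver-succ (subst (InLaver _ s) (restrict-suc x n) (x∈p (suc n)))
               (subst (length s ≤_) (sym (length-restrict x n)) |s|≤n)

InBranches-restrict : ∀ {A x} N → (∀ n → N ≤ n → set (A (restrict x n)) (x n))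
  → InBranches A (restrict x N) x
InBranches-restrict {A} {x} N tail∈A = branch
  where
  branch : ∀ n → InLaver A (restrict x N) (restrict x n)
  branch zero = below (restrict-prefix x (≤⇒≤′ z≤n))
  branch (suc n) with suc n ≤? N
  ... | yes n<N = below (restrict-prefix x (≤⇒≤′ n<N))
  ... | no  n≮N = subst (InLaver A (restrict x N)) (sym (restrict-suc x n))
                    (step (branch n) (restrict-prefix x (≤⇒≤′ N≤n)) (tail∈A n N≤n))
    where
    N≤n : N ≤ n
    N≤n = ≤-pred (≰⇒> n≮N)

maxLength : List Seq → ℕ
maxLength L = max 0 (map length L)

longer-∉ : ∀ {t L} → maxLength L < length t → ¬ (t ∈ L)
longer-∉ {L = L} L<t t∈L = <-irrefl refl (≤-<-trans (lookup (xs≤max 0 (map length L)) (∈-map⁺ length t∈L)) L<t)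

fact1p4 : (X : Baire → Set) (A B : Q) → B ≤* A
    → (∀ s x → ¬ (InBranches A s x × X x))
    → ∀ s x → ¬ (InBranches B s x × X x)
fact1p4 X A B (_ , L , B⊆A) A-misses-X s x (x∈pB , x∈X) =
  A-misses-X (restrict x N) x (InBranches-restrict N tail∈A , x∈X)
  where
  N : ℕ
  N = length s ⊔ suc (maxLength L)
  tail∈A : ∀ n → N ≤ n → set (A (restrict x n)) (x n)
  tail∈A n N≤n = B⊆A (restrict x n) (longer-∉ L<x↾n) (x n)
                   (InBranches-succ x∈pB n (≤-trans (m≤m⊔n _ _) N≤n))
    where
    L<x↾n : maxLength L < length (restrict x n)
    L<x↾n = subst (maxLength L <_) (sym (length-restrict x n)) (≤-trans (m≤n⊔m (length s) _) N≤n)
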